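{- Let $\mathfrak X$ be a homogeneous tree of degree $q+1$ ($q\geq1$) and let $\{f_j\}_{j\in\mathbb Z}$ be a wave on $\mathfrak X$. Then for all integers $m$ and $k$, $$f_{m+k}+f_{m-k}=2T_k(\mu_1)f_m.$$
   Context: $\mathfrak X$ is a tree in which every vertex has exactly $q+1$ edges; $\mathcal F(\mathfrak X)$ is the space of complex-valued functions on its vertices; $\mu_1f(v)=\frac{1}{q+1}\sum_{w\text{ adjacent to }v}f(w)$. A wave is a family $\{f_j\}_{j\in\mathbb Z}$ in $\mathcal F(\mathfrak X)$ with $\mu_1f_j=\frac{f_{j+1}+f_{j-1}}{2}$ for all $j\in\mathbb Z$. $T_m$ are Chebyshev polynomials of the first kind: $T_0=1$, $T_1(x)=x$, $T_{m+1}(x)=2xT_m(x)-T_{m-1}(x)$, and $T_{ -m}=T_m$. $P(\mu_1)$ denotes the polynomial $P$ applied to the operator $\mu_1$. -}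

module Defs where

open import Level using (Level)
open import Data.Nat using (ℕ; zero; suc)
open import Data.Fin using (Fin) renaming (_≟_ to _≟ᶠ_)
open import Data.List using (List; []; _∷_)
open import Data.Product using (Σ; _,_; proj₁; proj₂; _×_)
open import Data.Unit using (⊤; tt)
open import Relation.Binary.PropositionalEquality using (_≡_)
open import Relation.Nullary using (¬_; yes; no)
open import Algebra.Bundles using (CommutativeRing)

-- Reduced words over the alphabet Fin n (no two consecutive equal letters).
-- The head of the list is the most recently appended letter.
Reduced : {n : ℕ} → List (Fin n) → Set
Reduced [] = ⊤
Reduced (x ∷ []) = ⊤
Reduced (x ∷ y ∷ ys) = (¬ x ≡ y) × Reduced (y ∷ ys)

-- Vertices of the homogeneous tree of degree n: reduced words, i.e. elements of
-- the free product of n copies of Z/2Z (its Cayley graph is the n-regular tree).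
Vertex : ℕ → Set
Vertex n = Σ (List (Fin n)) Reduced

-- The a-th neighbour of a vertex (right multiplication by the generator a).
-- Every vertex has exactly n distinct neighbours nb v a, a : Fin n.
nb : {n : ℕ} → Vertex n → Fin n → Vertex n
nb ([] , _) a = (a ∷ [] , tt)
nb (x ∷ [] , r) a with a ≟ᶠ x
... | yes _ = ([] , tt)
... | no a≢x = (a ∷ x ∷ [] , a≢x , tt)
nb (x ∷ y ∷ ys , r) a with a ≟ᶠ x
... | yes _ = (y ∷ ys , proj₂ r)
... | no a≢x = (a ∷ x ∷ y ∷ ys , a≢x , r)

module TreeOps {c ℓ : Level} (R : CommutativeRing c ℓ) where
  open CommutativeRing R public

  two : Carrier
  two = 1# + 1#

  natR : ℕ → Carrier
  natR zero = 0#
  natR (suc k) = 1# + natR k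

  sumFin : (n : ℕ) → (Fin n → Carrier) → Carrier
  sumFin zero g = 0#
  sumFin (suc n) g = g Fin.zero + sumFin n (λ i → g (Fin.suc i))

  F : ℕ → Set c
  F q = Vertex (suc q) → Carrier

  -- μ₁ f (v) = (1/(q+1)) Σ_{w ~ v} f(w), where inv is the inverse of (q+1)
  μ₁ : (q : ℕ) (inv : Carrier) → F q → F q
  μ₁ q inv f v = inv * sumFin (suc q) (λ a → f (nb v a))

  -- T_k(μ₁), via the Chebyshev recurrence T_0 = 1, T_1 = x, T_{k+2} = 2x T_{k+1} - T_k
  Tμ : (q : ℕ) (inv : Carrier) → ℕ → F q → F q
  Tμ q inv zero f = f
  Tμ q inv (suc zero) f = μ₁ q inv f
  Tμ q inv (suc (suc k)) f v =
    two * μ₁ q inv (Tμ q inv (suc k) f) v - Tμ q inv k f v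

{-# OPTIONS --safe #-}
module Submission where

-- The symmetric sums g k = f (m + k) + f (m - k) of a wave f again form a wave, since μ₁ is
-- additive and reflecting or shifting the time index preserves the wave equation.  On k ≥ 0 a
-- wave obeys the Chebyshev recurrence g (k+2) + g k = 2 μ₁ (g (k+1)), and so does
-- k ↦ 2 T_k(μ₁) f m; both sequences start with 2 f m and 2 μ₁ f m (the wave equation at m),
-- hence agree.  Negative k reduce to positive ones because g (-k) = g k.

open import Defs
open import Level using (Level)
open import Data.Nat using (ℕ; _≤_; zero; suc)
open import Data.Integer using (ℤ; ∣_∣; +_; -[1+_]; -1ℤ; 0ℤ) renaming (_+_ to _+ℤ_; _-_ to _-ℤ_; 1ℤ to oneℤ)
open import Algebra.Bundles using (CommutativeRing)
open import Data.Fin using (Fin; zero; suc)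
import Data.Integer.Properties as ℤ
open import Data.Integer.Tactic.RingSolver using (solve-∀)
open import Function using (_∘_)
open import Relation.Binary.PropositionalEquality as ≡ using (_≡_)

[m-k]-1≡m-[k+1] : ∀ m k → (m -ℤ k) -ℤ oneℤ ≡ m -ℤ (k +ℤ oneℤ)
[m-k]-1≡m-[k+1] = solve-∀

[m-k]+1≡m-[k-1] : ∀ m k → (m -ℤ k) +ℤ oneℤ ≡ m -ℤ (k -ℤ oneℤ)
[m-k]+1≡m-[k-1] = solve-∀

module _ {c ℓ : Level} (R : CommutativeRing c ℓ) where
  open TreeOps R
  open import Algebra.Properties.Semiring.Sum semiring using (sum; sum-cong-≋; ∑-distrib-+; *-distribˡ-sum)
  open import Algebra.Properties.Group +-group using (∙-cancelʳ; //-rightDividesˡ)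
  open import Algebra.Properties.CommutativeSemigroup +-commutativeSemigroup using (interchange)
  open import Algebra.Properties.CommutativeSemigroup *-commutativeSemigroup using (x∙yz≈y∙xz)
  open import Relation.Binary.Reasoning.Setoid setoid

  infix 4 _≋_
  _≋_ : {X : Set} → (X → Carrier) → (X → Carrier) → Set ℓ
  g ≋ h = ∀ x → g x ≈ h x

  symmetricSum : {X : Set} → (ℤ → X → Carrier) → ℤ → ℤ → X → Carrier
  symmetricSum f m k x = f (m +ℤ k) x + f (m -ℤ k) x

  two*x≈x+x : ∀ x → two * x ≈ x + x
  two*x≈x+x x = trans (distribʳ x 1# 1#) (+-cong (*-identityˡ x) (*-identityˡ x))

  sumFin≡sum : ∀ n (g : Fin n → Carrier) → sumFin n g ≡ sum g
  sumFin≡sum zero    g = ≡.refl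
  sumFin≡sum (suc n) g = ≡.cong₂ _+_ ≡.refl (sumFin≡sum n (g ∘ suc))

  module _ (q : ℕ) (inv : Carrier) where

    μ₁≡inv*sum : ∀ (g : F q) v → μ₁ q inv g v ≡ inv * sum (g ∘ nb v)
    μ₁≡inv*sum g v = ≡.cong (inv *_) (sumFin≡sum (suc q) (g ∘ nb v))

    μ₁-cong : ∀ {g h : F q} → g ≋ h → μ₁ q inv g ≋ μ₁ q inv h
    μ₁-cong {g} {h} g≋h v = begin
      μ₁ q inv g v         ≡⟨ μ₁≡inv*sum g v ⟩
      inv * sum (g ∘ nb v) ≈⟨ *-congˡ (sum-cong-≋ (g≋h ∘ nb v)) ⟩
      inv * sum (h ∘ nb v) ≡⟨ μ₁≡inv*sum h v ⟨
      μ₁ q inv h v         ∎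

    μ₁-additive : ∀ (g h : F q) → μ₁ q inv (λ w → g w + h w) ≋ λ v → μ₁ q inv g v + μ₁ q inv h v
    μ₁-additive g h v = begin
      μ₁ q inv (λ w → g w + h w) v                    ≡⟨ μ₁≡inv*sum (λ w → g w + h w) v ⟩
      inv * sum (λ a → g (nb v a) + h (nb v a))       ≈⟨ *-congˡ (∑-distrib-+ (g ∘ nb v) (h ∘ nb v)) ⟩
      inv * (sum (g ∘ nb v) + sum (h ∘ nb v))         ≈⟨ distribˡ inv _ _ ⟩
      inv * sum (g ∘ nb v) + inv * sum (h ∘ nb v)     ≡⟨ ≡.cong₂ _+_ (μ₁≡inv*sum g v) (μ₁≡inv*sum h v) ⟨
      μ₁ q inv g v + μ₁ q inv h v                     ∎

    μ₁-homogeneous : ∀ y (g : F q) → μ₁ q inv (λ w → y * g w) ≋ λ v → y * μ₁ q inv g v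
    μ₁-homogeneous y g v = begin
      μ₁ q inv (λ w → y * g w) v      ≡⟨ μ₁≡inv*sum (λ w → y * g w) v ⟩
      inv * sum (λ a → y * g (nb v a)) ≈⟨ *-congˡ (*-distribˡ-sum y (g ∘ nb v)) ⟨
      inv * (y * sum (g ∘ nb v))      ≈⟨ x∙yz≈y∙xz inv y _ ⟩
      y * (inv * sum (g ∘ nb v))      ≡⟨ ≡.cong (y *_) (μ₁≡inv*sum g v) ⟨
      y * μ₁ q inv g v                ∎

  module _ {X : Set} (L : (X → Carrier) → X → Carrier) where

    IsWave : (ℤ → X → Carrier) → Set ℓ
    IsWave f = ∀ j x → f (j +ℤ oneℤ) x + f (j -ℤ oneℤ) x ≈ two * L (f j) x

    ChebyshevRecurrence : (ℕ → X → Carrier) → Set ℓ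
    ChebyshevRecurrence s = ∀ n x → s (suc (suc n)) x + s n x ≈ two * L (s (suc n)) x

    halfMean⇒isWave : ∀ {half} {f} → two * half ≈ 1# →
      (∀ j x → L (f j) x ≈ half * (f (j +ℤ oneℤ) x + f (j -ℤ oneℤ) x)) → IsWave f
    halfMean⇒isWave {half} {f} two*half≈1 mean j x = sym (begin
      two * L (f j) x                  ≈⟨ *-congˡ (mean j x) ⟩
      two * (half * neighbours)        ≈⟨ *-assoc two half _ ⟨
      (two * half) * neighbours        ≈⟨ *-congʳ two*half≈1 ⟩
      1# * neighbours                  ≈⟨ *-identityˡ _ ⟩
      neighbours                       ∎)
      where neighbours = f (j +ℤ oneℤ) x + f (j -ℤ oneℤ) x

    symmetricSum-isWave : (∀ g h → L (λ y → g y + h y) ≋ λ x → L g x + L h x) →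
      ∀ {f} → IsWave f → ∀ m → IsWave (symmetricSum f m)
    symmetricSum-isWave L-additive {f} wave m k x = begin
      (φ (m +ℤ (k +ℤ oneℤ)) + φ (m -ℤ (k +ℤ oneℤ))) + (φ (m +ℤ (k -ℤ oneℤ)) + φ (m -ℤ (k -ℤ oneℤ)))
        ≡⟨ ≡.cong₂ _+_ (≡.cong₂ _+_ (≡.cong φ (ℤ.+-assoc m k oneℤ)) (≡.cong φ ([m-k]-1≡m-[k+1] m k)))
                     (≡.cong₂ _+_ (≡.cong φ (ℤ.+-assoc m k -1ℤ)) (≡.cong φ ([m-k]+1≡m-[k-1] m k))) ⟨
      (φ (a +ℤ oneℤ) + φ (b -ℤ oneℤ)) + (φ (a -ℤ oneℤ) + φ (b +ℤ oneℤ))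
        ≈⟨ interchange _ _ _ _ ⟩
      (φ (a +ℤ oneℤ) + φ (a -ℤ oneℤ)) + (φ (b -ℤ oneℤ) + φ (b +ℤ oneℤ))
        ≈⟨ +-cong (wave a x) (trans (+-comm _ _) (wave b x)) ⟩
      two * L (f a) x + two * L (f b) x
        ≈⟨ distribˡ two _ _ ⟨
      two * (L (f a) x + L (f b) x)
        ≈⟨ *-congˡ (L-additive (f a) (f b) x) ⟨
      two * L (symmetricSum f m k) x ∎
      where
      φ : ℤ → Carrier
      φ i = f i x
      a b : ℤ
      a = m +ℤ k
      b = m -ℤ k

    isWave⇒chebyshevRecurrence : ∀ {f} → IsWave f → ChebyshevRecurrence (f ∘ +_)
    isWave⇒chebyshevRecurrence {f} wave n x = begin
      f (+ suc (suc n)) x + f (+ n) x            ≡⟨ ≡.cong (λ i → f i x + f (+ n) x) (ℤ.+-comm (+ suc n) oneℤ) ⟨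
      f (+ suc n +ℤ oneℤ) x + f (+ n) x          ≈⟨ wave (+ suc n) x ⟩
      two * L (f (+ suc n)) x                    ∎

    chebyshevRecurrence-unique : (∀ {g h} → g ≋ h → L g ≋ L h) →
      ∀ {s t} → ChebyshevRecurrence s → ChebyshevRecurrence t →
      s 0 ≋ t 0 → s 1 ≋ t 1 → ∀ n → s n ≋ t n
    chebyshevRecurrence-unique L-cong {s} {t} s-rec t-rec s₀≋t₀ s₁≋t₁ = agree
      where
      agree : ∀ n → s n ≋ t n
      agree zero          = s₀≋t₀
      agree (suc zero)    = s₁≋t₁
      agree (suc (suc n)) x = ∙-cancelʳ (s n x) _ _ (begin
        s (suc (suc n)) x + s n x  ≈⟨ s-rec n x ⟩
        two * L (s (suc n)) x      ≈⟨ *-congˡ (L-cong (agree (suc n)) x) ⟩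
        two * L (t (suc n)) x      ≈⟨ t-rec n x ⟨
        t (suc (suc n)) x + t n x  ≈⟨ +-congˡ (agree n x) ⟨
        t (suc (suc n)) x + s n x  ∎)

  Tμ-chebyshevRecurrence : ∀ q inv y (g : F q) →
    ChebyshevRecurrence (μ₁ q inv) (λ n v → y * Tμ q inv n g v)
  Tμ-chebyshevRecurrence q inv y g n v = begin
    y * (two * μ₁ q inv T′ v - T v) + y * T v  ≈⟨ distribˡ y _ _ ⟨
    y * ((two * μ₁ q inv T′ v - T v) + T v)    ≈⟨ *-congˡ (//-rightDividesˡ (T v) _) ⟩
    y * (two * μ₁ q inv T′ v)                  ≈⟨ x∙yz≈y∙xz y two _ ⟩
    two * (y * μ₁ q inv T′ v)                  ≈⟨ *-congˡ (μ₁-homogeneous q inv y T′ v) ⟨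
    two * μ₁ q inv (λ w → y * T′ w) v          ∎
    where
    T T′ : F q
    T  = Tμ q inv n g
    T′ = Tμ q inv (suc n) g

  wave-symmetricSum≈two*Tμ : ∀ q inv {f : ℤ → F q} → IsWave (μ₁ q inv) f →
    ∀ m k → symmetricSum f m k ≋ λ v → two * Tμ q inv ∣ k ∣ (f m) v
  wave-symmetricSum≈two*Tμ q inv {f} wave m (+ n) =
    chebyshevRecurrence-unique μ (μ₁-cong q inv)
      (isWave⇒chebyshevRecurrence μ {g} (symmetricSum-isWave μ (μ₁-additive q inv) {f} wave m))
      (Tμ-chebyshevRecurrence q inv two (f m))
      g₀≋two*fₘ (wave m) n
    where
    μ : F q → F q
    μ = μ₁ q inv
    g : ℤ → F q
    g = symmetricSum f m
    g₀≋two*fₘ : g 0ℤ ≋ λ v → two * f m v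
    g₀≋two*fₘ v rewrite ℤ.+-identityʳ m = sym (two*x≈x+x (f m v))
  -- m + -[1+ n ] and m - -[1+ n ] compute to m - + suc n and m + + suc n: the summands just swap.
  wave-symmetricSum≈two*Tμ q inv wave m -[1+ n ] v =
    trans (+-comm _ _) (wave-symmetricSum≈two*Tμ q inv wave m (+ suc n) v)

lemma4p1 : {c ℓ : Level} (R : CommutativeRing c ℓ) →
    let open TreeOps R in
    (q : ℕ) → 1 ≤ q →
    (half inv : Carrier) → two * half ≈ 1# → natR (ℕ.suc q) * inv ≈ 1# →
    (f : ℤ → F q) →
    (∀ (j : ℤ) (v : Vertex (ℕ.suc q)) →
      μ₁ q inv (f j) v ≈ half * (f (j +ℤ oneℤ) v + f (j -ℤ oneℤ) v)) →
    ∀ (m k : ℤ) (v : Vertex (ℕ.suc q)) →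
      f (m +ℤ k) v + f (m -ℤ k) v ≈ two * Tμ q inv ∣ k ∣ (f m) v
lemma4p1 R q _ half inv two*half≈1 _ f mean =
  wave-symmetricSum≈two*Tμ R q inv (halfMean⇒isWave R (TreeOps.μ₁ R q inv) {f = f} two*half≈1 mean)
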